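{- In the $F_4$ Black Hole Zeckendorf game: the position $(1,0,c)$ is a $P$ position for all $c\in\mathbb{Z}_{\ge0}$ with $c\neq 3$; the position $(0,1,c)$ is a $P$ position for all $c\in\mathbb{Z}_{\ge0}$ with $c\notin\{1,2,6\}$; the position $(2,0,c)$ is an $N$ position for all $c\in\mathbb{Z}_{\ge0}$ with $c\neq 1$; and the positions $(1,1,c)$ and $(2,1,c)$ are $N$ positions for all $c\in\mathbb{Z}_{\ge0}$.
   Context: The $F_4$ Black Hole Zeckendorf game: a position is a triple $(a,b,c)$ of nonnegative integers, the numbers of pieces in the columns of weights $F_1=1$, $F_2=2$, $F_3=3$. Two players alternate moves; the available moves are: (M) if $a\ge2$, go to $(a-2,b+1,c)$; (A$_1$) if $a,b\ge1$, go to $(a-1,b-1,c+1)$; (A$_2$) if $b,c\ge1$, go to $(a,b-1,c-1)$; (S$_2$) if $b\ge2$, go to $(a+1,b-2,c+1)$; (S$_3$) if $c\ge2$, go to $(a+1,b,c-2)$ (pieces landing in column $F_4=5$, the "black hole", are removed). The player making the last move wins. A position is a $P$ position if the player to move from it loses under optimal play, and an $N$ position if the player to move can force a win; positions with no move are $P$ positions. -}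

module Defs where

open import Data.Nat using (ℕ; zero; suc)
open import Data.Product using (Σ; _×_; _,_)

-- A position (a , b , c): numbers of pieces in columns of weight F1=1, F2=2, F3=3.
Pos : Set
Pos = ℕ × ℕ × ℕ

-- Legal moves of the F4 Black Hole Zeckendorf game (pieces sent to F4 vanish).
data Move : Pos → Pos → Set where
  M  : ∀ {a b c} → Move (suc (suc a) , b , c) (a , suc b , c)
  A₁ : ∀ {a b c} → Move (suc a , suc b , c) (a , b , suc c)
  A₂ : ∀ {a b c} → Move (a , suc b , suc c) (a , b , c)
  S₂ : ∀ {a b c} → Move (a , suc (suc b) , c) (suc a , b , suc c)
  S₃ : ∀ {a b c} → Move (a , b , suc (suc c)) (suc a , b , c)

mutual
  data IsP (p : Pos) : Set where
    isP : (∀ q → Move p q → IsN q) → IsP p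

  data IsN (p : Pos) : Set where
    isN : ∀ q → Move p q → IsP q → IsN p

{-# OPTIONS --safe #-}
module Submission where

-- From (1,0,c+2) the only move is S₃, to (2,0,c); from (2,0,c+3) the move M
-- leads to (0,1,c+3), whose only two moves A₂ and S₃ can each be answered by
-- a move back to (1,0,c).  So (1,0,c) P gives (2,0,c+3) N, which gives
-- (1,0,c+5) P: an induction on c with step 5.  The single N position
-- (1,0,3) spoils only (0,1,6); (2,0,6) is still N through S₃ to the
-- P position (3,0,4).

open import Defs
open import Data.Nat using (ℕ; suc; _+_; _≟_)
open import Data.Nat.Properties using (suc-injective)
open import Data.Product using (_×_; _,_)
open import Data.Empty using (⊥-elim)
open import Function using (_∘_)
open import Relation.Nullary using (yes; no)
open import Relation.Binary.PropositionalEquality using (_≢_; refl; cong)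

N[0,1,1] : IsN (0 , 1 , 1)
N[0,1,1] = isN _ A₂ (isP λ _ ())

P[2,0,1] : IsP (2 , 0 , 1)
P[2,0,1] = isP λ { _ M → N[0,1,1] }

N[1,0,3] : IsN (1 , 0 , 3)
N[1,0,3] = isN _ S₃ P[2,0,1]

P[0,0,5] : IsP (0 , 0 , 5)
P[0,0,5] = isP λ { _ S₃ → N[1,0,3] }

P[0,2,2] : IsP (0 , 2 , 2)
P[0,2,2] = isP λ
  { _ A₂ → N[0,1,1]
  ; _ S₂ → N[1,0,3]
  ; _ S₃ → isN _ S₂ P[2,0,1]
  }

P[3,0,0] : IsP (3 , 0 , 0)
P[3,0,0] = isP λ { _ M → isN _ A₁ (isP λ _ ()) }

P[5,0,0] : IsP (5 , 0 , 0)
P[5,0,0] = isP λ { _ M → isN _ A₁ P[2,0,1] }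

P[3,0,4] : IsP (3 , 0 , 4)
P[3,0,4] = isP λ
  { _ M  → isN _ A₁ P[0,0,5]
  ; _ S₃ → isN _ S₃ P[5,0,0]
  }

N[2,0,c]⇒P[1,0,2+c] : ∀ {c} → IsN (2 , 0 , c) → IsP (1 , 0 , 2 + c)
N[2,0,c]⇒P[1,0,2+c] n = isP λ { _ S₃ → n }

P[1,0,c]⇒P[0,1,3+c] : ∀ {c} → IsP (1 , 0 , c) → IsP (0 , 1 , 3 + c)
P[1,0,c]⇒P[0,1,3+c] p = isP λ
  { _ A₂ → isN _ S₃ p
  ; _ S₃ → isN _ A₂ p
  }

P[1,0,c]⇒N[2,0,3+c] : ∀ {c} → IsP (1 , 0 , c) → IsN (2 , 0 , 3 + c)
P[1,0,c]⇒N[2,0,3+c] = isN _ M ∘ P[1,0,c]⇒P[0,1,3+c]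

mutual
  P[1,0,c] : ∀ c → c ≢ 3 → IsP (1 , 0 , c)
  P[1,0,c] 0 _ = isP λ _ ()
  P[1,0,c] 1 _ = isP λ _ ()
  P[1,0,c] (suc (suc c)) 2+c≢3 = N[2,0,c]⇒P[1,0,2+c] (N[2,0,c] c (2+c≢3 ∘ cong (2 +_)))

  N[2,0,c] : ∀ c → c ≢ 1 → IsN (2 , 0 , c)
  N[2,0,c] 0 _ = isN _ M (isP λ _ ())
  N[2,0,c] 1 c≢1 = ⊥-elim (c≢1 refl)
  N[2,0,c] 2 _ = isN _ S₃ P[3,0,0]
  N[2,0,c] (suc (suc (suc c))) _ with c ≟ 3
  ... | yes refl = isN _ S₃ P[3,0,4]
  ... | no c≢3 = P[1,0,c]⇒N[2,0,3+c] (P[1,0,c] c c≢3)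

P[0,1,c] : ∀ c → c ≢ 1 → c ≢ 2 → c ≢ 6 → IsP (0 , 1 , c)
P[0,1,c] 0 _ _ _ = isP λ _ ()
P[0,1,c] 1 c≢1 _ _ = ⊥-elim (c≢1 refl)
P[0,1,c] 2 _ c≢2 _ = ⊥-elim (c≢2 refl)
P[0,1,c] (suc (suc (suc c))) _ _ 3+c≢6 =
  P[1,0,c]⇒P[0,1,3+c] (P[1,0,c] c (3+c≢6 ∘ cong (3 +_)))

N[1,1,c] : ∀ c → IsN (1 , 1 , c)
N[1,1,c] 0 = isN _ A₁ (isP λ _ ())
N[1,1,c] (suc c) with c ≟ 3
... | yes refl = isN _ A₁ P[0,0,5]
... | no c≢3 = isN _ A₂ (P[1,0,c] c c≢3)

N[2,1,c] : ∀ c → IsN (2 , 1 , c)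
N[2,1,c] c with c ≟ 2
... | yes refl = isN _ M P[0,2,2]
... | no c≢2 = isN _ A₁ (P[1,0,c] (suc c) (c≢2 ∘ suc-injective))

corollary5p4 :
    (∀ (c : ℕ) → c ≢ 3 → IsP (1 , 0 , c))
    × (∀ (c : ℕ) → c ≢ 1 → c ≢ 2 → c ≢ 6 → IsP (0 , 1 , c))
    × (∀ (c : ℕ) → c ≢ 1 → IsN (2 , 0 , c))
    × (∀ (c : ℕ) → IsN (1 , 1 , c))
    × (∀ (c : ℕ) → IsN (2 , 1 , c))
corollary5p4 = P[1,0,c] , P[0,1,c] , N[2,0,c] , N[1,1,c] , N[2,1,c]
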